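{- Let $n$ be a non-negative integer and $m=\lfloor\frac{n+3}6\rfloor+\delta_{1,(n\bmod 6)}$. For each $i\in\{1,\dots,\lfloor\frac n3\rfloor\}$ choose $j_i\in\{2i,\dots,n-i\}$. Then the following set is a generating index set of $\mathcal{DST}(n)$: $$G_D=\{(2i+1,j_{2i+1}): i\in\{0,\dots,m-1\}\}\ \text{ if } n \text{ is even},\qquad G_D=\{(1,j_1)\}\cup\{(2i,j_{2i}): i\in\{1,\dots,m-1\}\}\ \text{ if } n \text{ is odd}.$$
   Context: A binary Steinhaus triangle of size $n$ is an array $(a_{i,j})_{1\le i\le j\le n}$ of elements of $\{0,1\}$ with $a_{i,j}\equiv a_{i-1,j-1}+a_{i-1,j}\pmod 2$ for $2\le i\le j\le n$. These triangles form a vector space over $\mathbb{Z}/2\mathbb{Z}$. The rotation is $r((a_{i,j}))=(a_{j-i+1,n-i+1})$ and the reflection is $h((a_{i,j}))=(a_{i,n-j+i})$. $\mathcal{DST}(n)$ is the subspace of triangles fixed by both $r$ and $h$. A subset $G\subseteq\{(i,j):1\le i\le j\le n\}$ is a generating index set of a subspace $V$ if $V\to\{0,1\}^G$, $(a_{i,j})\mapsto(a_{i,j})_{(i,j)\in G}$, is an isomorphism. The symbol $\delta_{a,(n\bmod b)}$ is $1$ if $n\equiv a\pmod b$ and $0$ otherwise. -}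

module Defs where

open import Data.Nat using (ℕ; zero; suc; _+_; _*_; _∸_; _≤_; _<_)
open import Data.Nat.DivMod using (_/_; _%_)
open import Data.Bool using (Bool; _xor_)
open import Data.Product using (_×_; ∃-syntax)
open import Data.Sum using (_⊎_)
open import Relation.Binary.PropositionalEquality using (_≡_)

-- A triangle is represented by a function a : ℕ → ℕ → Bool (Bool = ℤ/2ℤ,
-- xor = addition mod 2); only the entries a i j with 1 ≤ i ≤ j ≤ n matter.
Triangle : Set
Triangle = ℕ → ℕ → Bool

Index : ℕ → ℕ → ℕ → Set
Index n i j = 1 ≤ i × i ≤ j × j ≤ n

IsSteinhaus : ℕ → Triangle → Set
IsSteinhaus n a = ∀ i j → 2 ≤ i → i ≤ j → j ≤ n →
  a i j ≡ (a (i ∸ 1) (j ∸ 1) xor a (i ∸ 1) j)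

RotFixed : ℕ → Triangle → Set
RotFixed n a = ∀ i j → Index n i j → a (j ∸ i + 1) (n ∸ i + 1) ≡ a i j

RefFixed : ℕ → Triangle → Set
RefFixed n a = ∀ i j → Index n i j → a i (n ∸ j + i) ≡ a i j

IsDST : ℕ → Triangle → Set
IsDST n a = IsSteinhaus n a × RotFixed n a × RefFixed n a

IndexSet : Set₁
IndexSet = ℕ → ℕ → Set

-- G is a generating index set of DST(n): G is a subset of the index set and
-- the restriction map DST(n) → {0,1}^G is bijective (it is automatically linear).
-- Surjectivity: every assignment G → {0,1} (given as the restriction of some
-- f : ℕ → ℕ → Bool) is the restriction of an element of DST(n).
IsGeneratingIndexSetDST : ℕ → IndexSet → Set
IsGeneratingIndexSetDST n G =
  (∀ i j → G i j → Index n i j)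
  × (∀ a b → IsDST n a → IsDST n b →
       (∀ i j → G i j → a i j ≡ b i j) →
       ∀ i j → Index n i j → a i j ≡ b i j)
  × (∀ (f : ℕ → ℕ → Bool) → ∃[ a ] (IsDST n a × (∀ i j → G i j → a i j ≡ f i j)))

δ1mod6 : ℕ → ℕ
δ1mod6 n with n % 6
... | 1 = 1
... | _ = 0

mDST : ℕ → ℕ
mDST n = (n + 3) / 6 + δ1mod6 n

GD : ℕ → (ℕ → ℕ) → IndexSet
GD n j p q with n % 2
... | 0 = ∃[ i ] (i < mDST n × p ≡ 2 * i + 1 × q ≡ j (2 * i + 1))
... | _ = (p ≡ 1 × q ≡ j 1)
          ⊎ ∃[ i ] (1 ≤ i × i < mDST n × p ≡ 2 * i × q ≡ j (2 * i))

ValidChoice : ℕ → (ℕ → ℕ) → Set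
ValidChoice n j = ∀ i → 1 ≤ i → (i ≤ n / 3 ⊎ (i ≡ 1 × n % 2 ≡ 1)) →
  2 * i ≤ j i × j i ≤ n ∸ i

-- Deleting the three border lines (first row, last column, diagonal) of an
-- element of DST(3 + N) leaves its core, an element of DST(N) whose first row
-- sums to zero ("balanced"; for even N every element of DST(N) is balanced).
-- Conversely a balanced b ∈ DST(N) extends, for either value c of the entry
-- (1, 2), to an element of DST(3 + N) with core b (border extension), and an
-- element of DST(3 + N) with zero core and one zero entry (1, k),
-- 2 ≤ k ≤ N + 2, is zero (border-kernel).  So if G generates the balanced part
-- of DST(N), then {(1, k)} ∪ (G shifted by (1, 2)) generates DST(3 + N)
-- (top-layer); and for even N = 2h the shifted G alone generates the balanced
-- part of DST(3 + N), which is cut out by a zero at the middle entry (1, h + 2)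
-- (balanced-layer).  For n even, G_D(3 + n) and G_D(6 + n) are exactly such
-- layers over G_D(n) for the shifted choice t ↦ j (s + t) - 2s, so the theorem
-- follows by induction from n = 0, 2, 4 (for n = 1 there is no valid choice).
module Submission where

open import Defs
open import Data.Nat
open import Data.Nat.Properties
open import Data.Nat.DivMod
open import Data.Nat.Tactic.RingSolver using (solve-∀)
open import Data.Bool using (Bool; true; false; _xor_)
open import Data.Bool.Properties
  using (xor-assoc; xor-comm; xor-same; xor-identityʳ;
         not-distribˡ-xor; not-distribʳ-xor; xor-annihilates-not)
open import Data.Product
open import Data.Sum using (_⊎_; inj₁; inj₂)
open import Data.Empty
open import Function using (id; _∘_)
open import Relation.Nullary
open import Relation.Binary.PropositionalEquality

xor-interchange : ∀ a b c d → (a xor b) xor (c xor d) ≡ (a xor c) xor (b xor d)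
xor-interchange false b false d = refl
xor-interchange false b true  d = sym (not-distribʳ-xor b d)
xor-interchange true  b false d = sym (not-distribˡ-xor b d)
xor-interchange true  b true  d = xor-annihilates-not b d

xor-cancelʳ : ∀ a b → (a xor b) xor b ≡ a
xor-cancelʳ a b = trans (xor-assoc a b b) (trans (cong (a xor_) (xor-same b)) (xor-identityʳ a))

xor-cancelˡ : ∀ a b → a xor (a xor b) ≡ b
xor-cancelˡ a b = trans (sym (xor-assoc a a b)) (cong (_xor b) (xor-same a))

xor-telescope : ∀ a b c → (a xor b) xor (b xor c) ≡ a xor c
xor-telescope a b c = trans (xor-assoc a b (b xor c)) (cong (a xor_) (xor-cancelˡ b c))

xor≡false⇒≡ : ∀ a b → a xor b ≡ false → a ≡ b
xor≡false⇒≡ false false _ = refl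
xor≡false⇒≡ true  true  _ = refl

≡⇒xor≡false : ∀ a b → a ≡ b → a xor b ≡ false
≡⇒xor≡false a .a refl = xor-same a

-- The border of the extended triangle is given by such sums, and the
-- palindromic symmetry of a DST row makes its full sum computable.

window : (ℕ → Bool) → ℕ → ℕ → Bool
window y s zero    = false
window y s (suc l) = y s xor window y (suc s) l

window-snoc : ∀ y s l → window y s (suc l) ≡ window y s l xor y (s + l)
window-snoc y s zero rewrite +-identityʳ s = xor-identityʳ (y s)
window-snoc y s (suc l) rewrite window-snoc y (suc s) l | +-suc s l =
  sym (xor-assoc (y s) (window y (suc s) l) (y (suc (s + l))))

window-split : ∀ y s l₁ l₂ → window y s (l₁ + l₂) ≡ window y s l₁ xor window y (s + l₁) l₂
window-split y s zero l₂ rewrite +-identityʳ s = refl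
window-split y s (suc l₁) l₂ rewrite window-split y (suc s) l₁ l₂ | +-suc s l₁ =
  sym (xor-assoc (y s) (window y (suc s) l₁) (window y (suc (s + l₁)) l₂))

Palindrome : (ℕ → Bool) → ℕ → ℕ → Set
Palindrome y s L = ∀ t → t < L → y (s + t) ≡ y (s + (L ∸ suc t))

window-reverse : ∀ y s L → Palindrome y s L → ∀ l → l ≤ L →
                 window y s l ≡ window y (s + (L ∸ l)) l
window-reverse y s L pal zero _ = refl
window-reverse y s L pal (suc l) l<L = begin
  window y s (suc l)                                ≡⟨ window-snoc y s l ⟩
  window y s l xor y (s + l)                        ≡⟨ cong₂ _xor_ (window-reverse y s L pal l (<⇒≤ l<L)) (pal l l<L) ⟩
  window y (s + (L ∸ l)) l xor y (s + (L ∸ suc l))  ≡⟨ xor-comm (window y (s + (L ∸ l)) l) (y (s + (L ∸ suc l))) ⟩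
  y (s + (L ∸ suc l)) xor window y (s + (L ∸ l)) l  ≡⟨ cong (λ z → y (s + (L ∸ suc l)) xor window y z l) start ⟩
  window y (s + (L ∸ suc l)) (suc l)                ∎
  where
  open ≡-Reasoning
  start : s + (L ∸ l) ≡ suc (s + (L ∸ suc l))
  start = trans (cong (s +_) (+-∸-assoc 1 l<L)) (+-suc s (L ∸ suc l))

window-even : ∀ y s h → Palindrome y s (h + h) → window y s (h + h) ≡ false
window-even y s h pal = begin
  window y s (h + h)                        ≡⟨ window-split y s h h ⟩
  window y s h xor window y (s + h) h       ≡⟨ cong (_xor window y (s + h) h) first≡second ⟩
  window y (s + h) h xor window y (s + h) h ≡⟨ xor-same (window y (s + h) h) ⟩
  false                                     ∎
  where
  open ≡-Reasoning
  first≡second : window y s h ≡ window y (s + h) h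
  first≡second = trans (window-reverse y s (h + h) pal h (m≤m+n h h))
                       (cong (λ z → window y (s + z) h) (m+n∸n≡m h h))

window-odd : ∀ y s h → Palindrome y s (h + suc h) → window y s (h + suc h) ≡ y (s + h)
window-odd y s h pal = begin
  window y s (h + suc h)                                           ≡⟨ window-split y s h (suc h) ⟩
  window y s h xor (y (s + h) xor window y (suc (s + h)) h)        ≡⟨ cong (_xor (y (s + h) xor window y (suc (s + h)) h)) first≡last ⟩
  window y (suc (s + h)) h xor (y (s + h) xor window y (suc (s + h)) h) ≡⟨ middle-survives (window y (suc (s + h)) h) (y (s + h)) ⟩
  y (s + h)                                                        ∎
  where
  open ≡-Reasoning
  first≡last : window y s h ≡ window y (suc (s + h)) h
  first≡last = trans (window-reverse y s (h + suc h) pal h (m≤m+n h (suc h)))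
                     (cong (λ z → window y z h) (trans (cong (s +_) (m+n∸m≡n h (suc h))) (+-suc s h)))
  middle-survives : ∀ a b → a xor (b xor a) ≡ b
  middle-survives a b = trans (cong (a xor_) (xor-comm b a)) (xor-cancelˡ a b)

zeroTriangle : Triangle
zeroTriangle _ _ = false

zero-DST : ∀ n → IsDST n zeroTriangle
zero-DST n = (λ _ _ _ _ _ → refl) , (λ _ _ _ → refl) , (λ _ _ _ → refl)

_⊕_ : Triangle → Triangle → Triangle
(a ⊕ b) i j = a i j xor b i j

⊕-DST : ∀ n a b → IsDST n a → IsDST n b → IsDST n (a ⊕ b)
⊕-DST n a b (sa , ra , ha) (sb , rb , hb) = steinhaus , rotation , reflection
  where
  steinhaus : IsSteinhaus n (a ⊕ b)
  steinhaus i j 2≤i i≤j j≤n =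
    trans (cong₂ _xor_ (sa i j 2≤i i≤j j≤n) (sb i j 2≤i i≤j j≤n))
          (xor-interchange (a (i ∸ 1) (j ∸ 1)) (a (i ∸ 1) j) (b (i ∸ 1) (j ∸ 1)) (b (i ∸ 1) j))
  rotation : RotFixed n (a ⊕ b)
  rotation i j ix = cong₂ _xor_ (ra i j ix) (rb i j ix)
  reflection : RefFixed n (a ⊕ b)
  reflection i j ix = cong₂ _xor_ (ha i j ix) (hb i j ix)

⊕≡false⇒≡ : ∀ a b i j → (a ⊕ b) i j ≡ false → a i j ≡ b i j
⊕≡false⇒≡ a b i j = xor≡false⇒≡ (a i j) (b i j)

core : Triangle → Triangle
core a i j = a (suc i) (suc (suc j))

core-DST : ∀ N a → IsDST (3 + N) a → IsDST N (core a)
core-DST N a (sa , ra , ha) = steinhaus , rotation , reflection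
  where
  steinhaus : IsSteinhaus N (core a)
  steinhaus (suc (suc i)) (suc j) (s≤s (s≤s z≤n)) (s≤s i≤j) j≤N =
    sa (3 + i) (3 + j) (s≤s (s≤s z≤n)) (s≤s (s≤s (s≤s (≤-trans (n≤1+n i) i≤j))))
       (s≤s (s≤s (s≤s (≤-trans (n≤1+n j) j≤N))))
  rotation : RotFixed N (core a)
  rotation i j (1≤i , i≤j , j≤N) =
    subst₂ (λ u v → a (u + 1) (v + 1) ≡ a (suc i) (suc (suc j)))
      (+-∸-assoc 1 i≤j)
      (trans (+-∸-assoc 1 (m≤n⇒m≤1+n (≤-trans i≤j j≤N))) (cong suc (+-∸-assoc 1 (≤-trans i≤j j≤N))))
      (ra (suc i) (suc (suc j)) (s≤s z≤n , m≤n⇒m≤1+n (s≤s i≤j) , s≤s (s≤s (m≤n⇒m≤1+n j≤N))))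
  reflection : RefFixed N (core a)
  reflection i j (1≤i , i≤j , j≤N) =
    subst (λ u → a (suc i) u ≡ a (suc i) (suc (suc j)))
      (trans (cong (_+ suc i) (+-∸-assoc 1 j≤N)) (cong suc (+-suc (N ∸ j) i)))
      (ha (suc i) (suc (suc j)) (s≤s z≤n , m≤n⇒m≤1+n (s≤s i≤j) , s≤s (s≤s (m≤n⇒m≤1+n j≤N))))

zeroTopRow⇒zero : ∀ n a → IsSteinhaus n a → (∀ j → 1 ≤ j → j ≤ n → a 1 j ≡ false) →
                  ∀ i j → Index n i j → a i j ≡ false
zeroTopRow⇒zero n a sa top (suc zero) j (_ , 1≤j , j≤n) = top j 1≤j j≤n
zeroTopRow⇒zero n a sa top (suc (suc i)) (suc j) (_ , s≤s i≤j , j≤n) =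
  trans (sa (2 + i) (suc j) (s≤s (s≤s z≤n)) (s≤s i≤j) j≤n)
    (cong₂ _xor_ (zeroTopRow⇒zero n a sa top (suc i) j (s≤s z≤n , i≤j , ≤-trans (n≤1+n j) j≤n))
                 (zeroTopRow⇒zero n a sa top (suc i) (suc j) (s≤s z≤n , m≤n⇒m≤1+n i≤j , j≤n)))

topRow-palindrome : ∀ N a → RefFixed N a → Palindrome (a 1) 1 N
topRow-palindrome N a ha t t<N =
  sym (subst (λ u → a 1 u ≡ a 1 (suc t)) (+-comm (N ∸ suc t) 1)
             (ha 1 (suc t) (s≤s z≤n , s≤s z≤n , t<N)))

topRow-sum-even : ∀ h a → IsDST (h + h) a → window (a 1) 1 (h + h) ≡ false
topRow-sum-even h a (_ , _ , ha) = window-even (a 1) 1 h (topRow-palindrome (h + h) a ha)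

topRow-sum-odd : ∀ h a → IsDST (3 + (h + h)) a → window (a 1) 1 (3 + (h + h)) ≡ a 1 (2 + h)
topRow-sum-odd h a (_ , _ , ha) =
  subst (λ L → window (a 1) 1 L ≡ a 1 (2 + h)) length
    (window-odd (a 1) 1 (suc h)
      (subst (Palindrome (a 1) 1) (sym length) (topRow-palindrome (3 + (h + h)) a ha)))
  where
  length : suc h + suc (suc h) ≡ 3 + (h + h)
  length = cong suc (trans (+-suc h (suc h)) (cong suc (+-suc h h)))

-- By
-- topRow-sum-even every element of DST(n) is balanced for even n; for odd n
-- the balanced triangles are those with a zero in the middle of the first row.
Balanced : ℕ → Triangle → Set
Balanced n a = IsDST n a × window (a 1) 1 n ≡ false

-- The core of any element of DST(3 + N) is balanced: the second row of a
-- Steinhaus triangle is the sequence of differences of the first row, so the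
-- sum telescopes to a 1 2 xor a 1 (2 + N), and these two entries agree by
-- the reflection symmetry.
core-balanced : ∀ N a → IsDST (3 + N) a → Balanced N (core a)
core-balanced N a aD@(sa , _ , ha) = core-DST N a aD , trans (telescope N ≤-refl) ends-agree
  where
  telescope : ∀ l → l ≤ N → window (core a 1) 1 l ≡ a 1 2 xor a 1 (2 + l)
  telescope zero _ = sym (xor-same (a 1 2))
  telescope (suc l) l<N = begin
    window (core a 1) 1 (suc l)                                  ≡⟨ window-snoc (core a 1) 1 l ⟩
    window (core a 1) 1 l xor a 2 (3 + l)                        ≡⟨ cong₂ _xor_ (telescope l (<⇒≤ l<N)) second-row ⟩
    (a 1 2 xor a 1 (2 + l)) xor (a 1 (2 + l) xor a 1 (3 + l))    ≡⟨ xor-telescope (a 1 2) (a 1 (2 + l)) (a 1 (3 + l)) ⟩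
    a 1 2 xor a 1 (3 + l)                                        ∎
    where
    open ≡-Reasoning
    second-row : a 2 (3 + l) ≡ a 1 (2 + l) xor a 1 (3 + l)
    second-row = sa 2 (3 + l) (s≤s (s≤s z≤n)) (s≤s (s≤s z≤n)) (s≤s (s≤s (s≤s (<⇒≤ l<N))))
  ends-agree : a 1 2 xor a 1 (2 + N) ≡ false
  ends-agree = ≡⇒xor≡false (a 1 2) (a 1 (2 + N))
    (sym (subst (λ u → a 1 u ≡ a 1 2) (+-comm (suc N) 1)
                (ha 1 2 (s≤s z≤n , s≤s z≤n , s≤s (s≤s z≤n)))))

constant-run : ∀ (f : ℕ → Bool) lo hi → (∀ t → lo ≤ t → t < hi → f t ≡ f (suc t)) →
               ∀ t → lo ≤ t → t ≤ hi → f t ≡ f lo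
constant-run f lo hi step zero z≤n _ = refl
constant-run f lo hi step (suc t) lo≤1+t 1+t≤hi with m≤n⇒m<n∨m≡n lo≤1+t
... | inj₂ refl = refl
... | inj₁ (s≤s lo≤t) =
  trans (sym (step t lo≤t 1+t≤hi)) (constant-run f lo hi step t lo≤t (<⇒≤ 1+t≤hi))

-- The zero second row forces d 1 2 = … = d 1 (2 + N),
-- hence all zero; the two corners of the first row then vanish by symmetry.
border-kernel : ∀ N d → IsDST (3 + N) d → (∀ i j → Index N i j → core d i j ≡ false) →
                ∀ k → 2 ≤ k → k ≤ 2 + N → d 1 k ≡ false →
                ∀ i j → Index (3 + N) i j → d i j ≡ false
border-kernel N d (sd , rd , hd) core≡0 k 2≤k k≤2+N d1k≡0 = zeroTopRow⇒zero (3 + N) d sd topRow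
  where
  consecutive : ∀ t → 2 ≤ t → t < 2 + N → d 1 t ≡ d 1 (suc t)
  consecutive (suc (suc t)) (s≤s (s≤s z≤n)) (s≤s (s≤s t<N)) =
    xor≡false⇒≡ (d 1 (2 + t)) (d 1 (3 + t))
      (trans (sym (sd 2 (3 + t) (s≤s (s≤s z≤n)) (s≤s (s≤s z≤n)) (s≤s (s≤s (m≤n⇒m≤1+n t<N)))))
             (core≡0 1 (suc t) (s≤s z≤n , s≤s z≤n , t<N)))
  middle : ∀ t → 2 ≤ t → t ≤ 2 + N → d 1 t ≡ false
  middle t 2≤t t≤2+N =
    trans (constant-run (d 1) 2 (2 + N) consecutive t 2≤t t≤2+N)
          (trans (sym (constant-run (d 1) 2 (2 + N) consecutive k 2≤k k≤2+N)) d1k≡0)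
  d12≡0 : d 1 2 ≡ false
  d12≡0 = middle 2 ≤-refl (s≤s (s≤s z≤n))
  d22≡0 : d 2 2 ≡ false
  d22≡0 = begin
    d 2 2        ≡⟨ subst (λ u → d 2 (u + 2) ≡ d 2 (3 + N)) (n∸n≡0 (3 + N))
                          (hd 2 (3 + N) (s≤s z≤n , s≤s (s≤s z≤n) , ≤-refl)) ⟩
    d 2 (3 + N)  ≡⟨ subst (λ u → d 2 u ≡ d 1 2) (+-comm (2 + N) 1)
                          (rd 1 2 (s≤s z≤n , s≤s z≤n , s≤s (s≤s z≤n))) ⟩
    d 1 2        ≡⟨ d12≡0 ⟩
    false        ∎
    where open ≡-Reasoning
  d11≡0 : d 1 1 ≡ false
  d11≡0 = begin
    d 1 1                ≡⟨ sym (xor-identityʳ (d 1 1)) ⟩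
    d 1 1 xor false      ≡⟨ cong (d 1 1 xor_) (sym d12≡0) ⟩
    d 1 1 xor d 1 2      ≡⟨ sym (sd 2 2 (s≤s (s≤s z≤n)) ≤-refl (s≤s (s≤s z≤n))) ⟩
    d 2 2                ≡⟨ d22≡0 ⟩
    false                ∎
    where open ≡-Reasoning
  topRow : ∀ j → 1 ≤ j → j ≤ 3 + N → d 1 j ≡ false
  topRow (suc zero) _ _ = d11≡0
  topRow (suc (suc j)) _ j≤1+N with m≤n⇒m<n∨m≡n j≤1+N
  ... | inj₁ (s≤s j<N) = middle (2 + j) (s≤s (s≤s z≤n)) j<N
  ... | inj₂ refl = trans (subst (λ u → d 1 u ≡ d 1 1) (+-comm (2 + N) 1)
                                 (hd 1 1 (s≤s z≤n , s≤s z≤n , s≤s z≤n)))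
                          d11≡0

-- Given b of size N and a bit c, extend b to a triangle of
-- size 3 + N with core b: the first row, the last column and the diagonal
-- all carry the same sequence edge 1, …, edge (3 + N), where
--   edge 1 = edge (3 + N) = false,   edge k = c xor (y 1 xor … xor y (k - 2))
-- for the first row y of b.  When b is balanced the result lies in DST(3 + N).
module BorderExtension (N : ℕ) (b : Triangle) (c : Bool) where

  y : ℕ → Bool
  y = b 1

  edge : ℕ → Bool
  edge k with k ≟ 1 | k ≟ 3 + N
  ... | yes _ | _     = false
  ... | no _  | yes _ = false
  ... | no _  | no _  = c xor window y 1 (k ∸ 2)

  extendBy : (i j : ℕ) → Dec (i ≡ 1) → Dec (j ≡ 3 + N) → Dec (i ≡ j) → Bool
  extendBy i j (yes _) _       _       = edge j
  extendBy i j (no _)  (yes _) _       = edge i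
  extendBy i j (no _)  (no _)  (yes _) = edge i
  extendBy i j (no _)  (no _)  (no _)  = b (i ∸ 1) (j ∸ 2)

  extend : Triangle
  extend i j = extendBy i j (i ≟ 1) (j ≟ 3 + N) (i ≟ j)

  edge-first : edge 1 ≡ false
  edge-first = refl

  edge-last : edge (3 + N) ≡ false
  edge-last with (3 + N) ≟ 1 | (3 + N) ≟ 3 + N
  ... | yes _ | _     = refl
  ... | no _  | yes _ = refl
  ... | no _  | no ≢  = ⊥-elim (≢ refl)

  edge-inner : ∀ k → 2 ≤ k → k ≤ 2 + N → edge k ≡ c xor window y 1 (k ∸ 2)
  edge-inner k 2≤k k≤2+N with k ≟ 1 | k ≟ 3 + N
  ... | yes refl | _        = ⊥-elim (1+n≰n 2≤k)
  ... | no _     | yes refl = ⊥-elim (1+n≰n k≤2+N)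
  ... | no _     | no _     = refl

  edge-step : ∀ k → suc k ≤ N → edge (3 + k) ≡ edge (2 + k) xor y (1 + k)
  edge-step k k<N = begin
    edge (3 + k)                                ≡⟨ edge-inner (3 + k) (s≤s (s≤s z≤n)) (s≤s (s≤s k<N)) ⟩
    c xor window y 1 (suc k)                    ≡⟨ cong (c xor_) (window-snoc y 1 k) ⟩
    c xor (window y 1 k xor y (1 + k))          ≡⟨ sym (xor-assoc c (window y 1 k) (y (1 + k))) ⟩
    (c xor window y 1 k) xor y (1 + k)          ≡⟨ cong (_xor y (1 + k)) (sym (edge-inner (2 + k) (s≤s (s≤s z≤n)) (s≤s (s≤s (<⇒≤ k<N))))) ⟩
    edge (2 + k) xor y (1 + k)                  ∎
    where open ≡-Reasoning

  extend-top : ∀ j → extend 1 j ≡ edge j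
  extend-top j = refl

  extend-right : ∀ i → i ≢ 1 → extend i (3 + N) ≡ edge i
  extend-right i i≢1 = cases (i ≟ 1) ((3 + N) ≟ 3 + N) (i ≟ 3 + N)
    where
    cases : ∀ d₁ d₂ d₃ → extendBy i (3 + N) d₁ d₂ d₃ ≡ edge i
    cases (yes i≡1) _     _ = ⊥-elim (i≢1 i≡1)
    cases (no _)    (yes _) _ = refl
    cases (no _)    (no ≢)  _ = ⊥-elim (≢ refl)

  extend-diagonal : ∀ i → i ≢ 1 → i ≢ 3 + N → extend i i ≡ edge i
  extend-diagonal i i≢1 i≢3+N = cases (i ≟ 1) (i ≟ 3 + N) (i ≟ i)
    where
    cases : ∀ d₁ d₂ d₃ → extendBy i i d₁ d₂ d₃ ≡ edge i
    cases (yes i≡1) _           _     = ⊥-elim (i≢1 i≡1)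
    cases (no _)    (yes i≡3+N) _     = ⊥-elim (i≢3+N i≡3+N)
    cases (no _)    (no _)      (yes _) = refl
    cases (no _)    (no _)      (no ≢)  = ⊥-elim (≢ refl)

  extend-interior : ∀ i j → i ≢ 1 → j ≢ 3 + N → i ≢ j → extend i j ≡ b (i ∸ 1) (j ∸ 2)
  extend-interior i j i≢1 j≢3+N i≢j with i ≟ 1 | j ≟ 3 + N | i ≟ j
  ... | yes i≡1 | _         | _       = ⊥-elim (i≢1 i≡1)
  ... | no _    | yes j≡3+N | _       = ⊥-elim (j≢3+N j≡3+N)
  ... | no _    | no _      | yes i≡j = ⊥-elim (i≢j i≡j)
  ... | no _    | no _      | no _    = refl

  extend-topRow : ∀ k → 2 ≤ k → k ≤ 2 + N → extend 1 k ≡ c xor window y 1 (k ∸ 2)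
  extend-topRow = edge-inner

  module OfBalanced (bB : Balanced N b) where

    private
      sb : IsSteinhaus N b
      sb = proj₁ (proj₁ bB)
      rb : RotFixed N b
      rb = proj₁ (proj₂ (proj₁ bB))
      hb : RefFixed N b
      hb = proj₂ (proj₂ (proj₁ bB))
      y-sum≡0 : window y 1 N ≡ false
      y-sum≡0 = proj₂ bB

    column-is-row : ∀ t → 1 ≤ t → t ≤ N → b t N ≡ y t
    column-is-row (suc t) 1≤t t≤N =
      subst₂ (λ u v → b u v ≡ y (suc t)) (+-comm t 1) (m∸n+n≡m {N} {1} (≤-trans 1≤t t≤N))
             (rb 1 (suc t) (s≤s z≤n , 1≤t , t≤N))

    diagonal-is-column : ∀ t → 1 ≤ t → t ≤ N → b t t ≡ b t N
    diagonal-is-column t 1≤t t≤N =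
      subst (λ u → b t (u + t) ≡ b t N) (n∸n≡0 N) (hb t N (1≤t , t≤N , ≤-refl))

    window-complement : ∀ k → k ≤ N → window y 1 (N ∸ k) ≡ window y 1 k
    window-complement k k≤N = begin
      window y 1 (N ∸ k)        ≡⟨ window-reverse y 1 N (topRow-palindrome N b hb) (N ∸ k) (m∸n≤m N k) ⟩
      window y (1 + (N ∸ (N ∸ k))) (N ∸ k) ≡⟨ cong (λ u → window y (1 + u) (N ∸ k)) (m∸[m∸n]≡n k≤N) ⟩
      window y (1 + k) (N ∸ k)  ≡⟨ sym (xor≡false⇒≡ (window y 1 k) (window y (1 + k) (N ∸ k)) whole) ⟩
      window y 1 k              ∎
      where
      open ≡-Reasoning
      whole : window y 1 k xor window y (1 + k) (N ∸ k) ≡ false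
      whole = trans (sym (window-split y 1 k (N ∸ k))) (trans (cong (window y 1) (m+[n∸m]≡n k≤N)) y-sum≡0)

    mirror : ∀ k → k ≤ N → (suc N ∸ k) + 1 ≡ 2 + (N ∸ k)
    mirror k k≤N = trans (cong (_+ 1) (+-∸-assoc 1 k≤N)) (+-comm (suc (N ∸ k)) 1)

    -- the border sequence is a palindrome; this gives both symmetries on the border
    edge-palindrome : ∀ k → 1 ≤ k → k ≤ 3 + N → edge ((3 + N) ∸ k + 1) ≡ edge k
    edge-palindrome (suc zero) _ _ = subst (λ u → edge u ≡ false) (+-comm 1 (2 + N)) edge-last
    edge-palindrome (suc (suc k)) _ (s≤s (s≤s k≤1+N)) with m≤n⇒m<n∨m≡n k≤1+N
    ... | inj₁ (s≤s k≤N) = begin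
      edge ((suc N ∸ k) + 1)           ≡⟨ cong edge (mirror k k≤N) ⟩
      edge (2 + (N ∸ k))               ≡⟨ edge-inner (2 + (N ∸ k)) (s≤s (s≤s z≤n)) (s≤s (s≤s (m∸n≤m N k))) ⟩
      c xor window y 1 (N ∸ k)         ≡⟨ cong (c xor_) (window-complement k k≤N) ⟩
      c xor window y 1 k               ≡⟨ sym (edge-inner (2 + k) (s≤s (s≤s z≤n)) (s≤s (s≤s k≤N))) ⟩
      edge (2 + k)                     ∎
      where open ≡-Reasoning
    ... | inj₂ refl = trans (cong (λ u → edge (u + 1)) (n∸n≡0 N)) (sym edge-last)

    -- The Steinhaus rule in the second row: there the upper neighbours lie on
    -- the first row, and the rule is edge-step (or, at the right end, the
    -- balancing condition window y 1 N = 0).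
    second-row : ∀ j → 2 ≤ j → j ≤ 3 + N → extend 2 j ≡ edge (j ∸ 1) xor edge j
    second-row (suc zero) (s≤s ()) _
    second-row (suc (suc zero)) _ _ = extend-diagonal 2 (λ ()) (λ ())
    second-row (suc (suc (suc k))) _ (s≤s (s≤s (s≤s k≤N))) with m≤n⇒m<n∨m≡n k≤N
    ... | inj₂ refl = begin
      extend 2 (3 + N)                 ≡⟨ extend-right 2 (λ ()) ⟩
      edge 2                           ≡⟨ edge-inner 2 ≤-refl (s≤s (s≤s z≤n)) ⟩
      c xor false                      ≡⟨ cong (c xor_) (sym y-sum≡0) ⟩
      c xor window y 1 N               ≡⟨ sym (edge-inner (2 + N) (s≤s (s≤s z≤n)) ≤-refl) ⟩
      edge (2 + N)                     ≡⟨ sym (xor-identityʳ (edge (2 + N))) ⟩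
      edge (2 + N) xor false           ≡⟨ cong (edge (2 + N) xor_) (sym edge-last) ⟩
      edge (2 + N) xor edge (3 + N)    ∎
      where open ≡-Reasoning
    ... | inj₁ k<N = begin
      extend 2 (3 + k)                 ≡⟨ extend-interior 2 (3 + k) (λ ()) (<⇒≢ (s≤s (s≤s (s≤s k<N)))) (λ ()) ⟩
      y (1 + k)                        ≡⟨ sym (xor-cancelˡ (edge (2 + k)) (y (1 + k))) ⟩
      edge (2 + k) xor (edge (2 + k) xor y (1 + k)) ≡⟨ cong (edge (2 + k) xor_) (sym (edge-step k k<N)) ⟩
      edge (2 + k) xor edge (3 + k)    ∎
      where open ≡-Reasoning

    -- The Steinhaus rule in the last column: the left neighbour is an entry
    -- of the last column of b, i.e. of y, so again it is edge-step; at the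
    -- bottom corner both upper neighbours carry edge (2 + N).
    last-column : ∀ i → i ≤ N → extend (3 + i) (3 + N) ≡ extend (2 + i) (2 + N) xor extend (2 + i) (3 + N)
    last-column i i≤N with m≤n⇒m<n∨m≡n i≤N
    ... | inj₂ refl = begin
      extend (3 + N) (3 + N)             ≡⟨ extend-right (3 + N) (λ ()) ⟩
      edge (3 + N)                       ≡⟨ edge-last ⟩
      false                              ≡⟨ sym (xor-same (edge (2 + N))) ⟩
      edge (2 + N) xor edge (2 + N)      ≡⟨ sym (cong₂ _xor_ (extend-diagonal (2 + N) (λ ()) (<⇒≢ ≤-refl))
                                                             (extend-right (2 + N) (λ ()))) ⟩
      extend (2 + N) (2 + N) xor extend (2 + N) (3 + N) ∎
      where open ≡-Reasoning
    ... | inj₁ i<N = begin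
      extend (3 + i) (3 + N)             ≡⟨ extend-right (3 + i) (λ ()) ⟩
      edge (3 + i)                       ≡⟨ edge-step i i<N ⟩
      edge (2 + i) xor y (1 + i)         ≡⟨ xor-comm (edge (2 + i)) (y (1 + i)) ⟩
      y (1 + i) xor edge (2 + i)         ≡⟨ sym (cong₂ _xor_ left (extend-right (2 + i) (λ ()))) ⟩
      extend (2 + i) (2 + N) xor extend (2 + i) (3 + N) ∎
      where
      open ≡-Reasoning
      left : extend (2 + i) (2 + N) ≡ y (1 + i)
      left = trans (extend-interior (2 + i) (2 + N) (λ ()) (<⇒≢ ≤-refl) (<⇒≢ (s≤s (s≤s i<N))))
                   (column-is-row (1 + i) (s≤s z≤n) i<N)

    -- The Steinhaus rule below the second row and left of the last column: on
    -- the diagonal the right neighbour is a diagonal entry of b, equal to an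
    -- entry of y, so it is edge-step; in the interior it is the rule for b.
    inner-columns : ∀ i j → i ≤ j → j < N →
                    extend (3 + i) (3 + j) ≡ extend (2 + i) (2 + j) xor extend (2 + i) (3 + j)
    inner-columns i j i≤j j<N with m≤n⇒m<n∨m≡n i≤j
    ... | inj₂ refl = begin
      extend (3 + j) (3 + j)             ≡⟨ extend-diagonal (3 + j) (λ ()) (<⇒≢ (s≤s (s≤s (s≤s j<N)))) ⟩
      edge (3 + j)                       ≡⟨ edge-step j j<N ⟩
      edge (2 + j) xor y (1 + j)         ≡⟨ sym (cong₂ _xor_ (extend-diagonal (2 + j) (λ ()) (<⇒≢ (s≤s (s≤s (s≤s (<⇒≤ j<N)))))) right) ⟩
      extend (2 + j) (2 + j) xor extend (2 + j) (3 + j) ∎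
      where
      open ≡-Reasoning
      right : extend (2 + j) (3 + j) ≡ y (1 + j)
      right = trans (extend-interior (2 + j) (3 + j) (λ ()) (<⇒≢ (s≤s (s≤s (s≤s j<N)))) (<⇒≢ ≤-refl))
                    (trans (diagonal-is-column (1 + j) (s≤s z≤n) j<N) (column-is-row (1 + j) (s≤s z≤n) j<N))
    ... | inj₁ i<j = begin
      extend (3 + i) (3 + j)             ≡⟨ extend-interior (3 + i) (3 + j) (λ ()) (<⇒≢ (s≤s (s≤s (s≤s j<N)))) (<⇒≢ (s≤s (s≤s (s≤s i<j)))) ⟩
      b (2 + i) (1 + j)                  ≡⟨ sb (2 + i) (1 + j) (s≤s (s≤s z≤n)) (s≤s i<j) j<N ⟩
      b (1 + i) j xor b (1 + i) (1 + j)  ≡⟨ sym (cong₂ _xor_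
           (extend-interior (2 + i) (2 + j) (λ ()) (<⇒≢ (s≤s (s≤s (s≤s (<⇒≤ j<N))))) (<⇒≢ (s≤s (s≤s i<j))))
           (extend-interior (2 + i) (3 + j) (λ ()) (<⇒≢ (s≤s (s≤s (s≤s j<N)))) (<⇒≢ (s≤s (s≤s (≤-trans i<j (n≤1+n j))))))) ⟩
      extend (2 + i) (2 + j) xor extend (2 + i) (3 + j) ∎
      where open ≡-Reasoning

    steinhaus : IsSteinhaus (3 + N) extend
    steinhaus (suc zero) j (s≤s ()) _ _
    steinhaus (suc (suc zero)) j _ 2≤j j≤3+N = second-row j 2≤j j≤3+N
    steinhaus (suc (suc (suc i))) (suc (suc (suc j))) _ (s≤s (s≤s (s≤s i≤j))) (s≤s (s≤s (s≤s j≤N)))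
      with m≤n⇒m<n∨m≡n j≤N
    ... | inj₂ refl = last-column i i≤j
    ... | inj₁ j<N  = inner-columns i j i≤j j<N

    -- The rotation maps the first row to the last column, the last column to
    -- the diagonal and the diagonal to the first row, reversing the order of
    -- the border sequence (harmless, as it is a palindrome); on the interior
    -- it acts as the rotation of b.
    rotation-last-column : ∀ i → 2 + i ≤ 3 + N →
                           extend ((3 + N) ∸ (2 + i) + 1) ((3 + N) ∸ (2 + i) + 1) ≡ extend (2 + i) (3 + N)
    rotation-last-column i (s≤s (s≤s i≤1+N)) with m≤n⇒m<n∨m≡n i≤1+N
    ... | inj₁ (s≤s i≤N) = begin
      extend (suc N ∸ i + 1) (suc N ∸ i + 1)  ≡⟨ cong (λ u → extend u u) (mirror i i≤N) ⟩
      extend (2 + (N ∸ i)) (2 + (N ∸ i))      ≡⟨ extend-diagonal (2 + (N ∸ i)) (λ ()) (<⇒≢ (s≤s (s≤s (s≤s (m∸n≤m N i))))) ⟩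
      edge (2 + (N ∸ i))                      ≡⟨ cong edge (sym (mirror i i≤N)) ⟩
      edge (suc N ∸ i + 1)                    ≡⟨ edge-palindrome (2 + i) (s≤s z≤n) (s≤s (s≤s (m≤n⇒m≤1+n i≤N))) ⟩
      edge (2 + i)                            ≡⟨ sym (extend-right (2 + i) (λ ())) ⟩
      extend (2 + i) (3 + N)                  ∎
      where open ≡-Reasoning
    ... | inj₂ refl =
      trans (cong (λ u → extend (u + 1) (u + 1)) (n∸n≡0 N))
            (trans edge-first (sym (trans (extend-right (3 + N) (λ ())) edge-last)))

    rotation-interior : ∀ i j → 2 + i < j → j < 3 + N →
                        extend (j ∸ (2 + i) + 1) ((3 + N) ∸ (2 + i) + 1) ≡ extend (2 + i) j
    rotation-interior i (suc (suc (suc j))) (s≤s (s≤s (s≤s i≤j))) (s≤s (s≤s (s≤s j<N))) = begin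
      extend (suc j ∸ i + 1) (suc N ∸ i + 1)  ≡⟨ cong₂ extend (trans (cong (_+ 1) (+-∸-assoc 1 i≤j)) (+-comm (suc (j ∸ i)) 1))
                                                             (mirror i (<⇒≤ i<N)) ⟩
      extend (2 + (j ∸ i)) (2 + (N ∸ i))      ≡⟨ extend-interior (2 + (j ∸ i)) (2 + (N ∸ i)) (λ ())
                                                   (<⇒≢ (s≤s (s≤s (s≤s (m∸n≤m N i))))) (<⇒≢ (s≤s (s≤s (∸-monoˡ-< j<N i≤j)))) ⟩
      b (1 + (j ∸ i)) (N ∸ i)                 ≡⟨ subst₂ (λ u v → b u v ≡ b (1 + i) (1 + j)) (+-comm (j ∸ i) 1)
                                                   (trans (+-comm (N ∸ suc i) 1) (sym (+-∸-assoc 1 i<N)))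
                                                   (rb (1 + i) (1 + j) (s≤s z≤n , s≤s i≤j , j<N)) ⟩
      b (1 + i) (1 + j)                       ≡⟨ sym (extend-interior (2 + i) (3 + j) (λ ()) (<⇒≢ (s≤s (s≤s (s≤s j<N)))) (<⇒≢ (s≤s (s≤s (s≤s i≤j))))) ⟩
      extend (2 + i) (3 + j)                  ∎
      where
      open ≡-Reasoning
      i<N : i < N
      i<N = ≤-<-trans i≤j j<N

    rotation : RotFixed (3 + N) extend
    rotation (suc zero) (suc zero) _ =
      trans (cong (extend 1) (+-comm (2 + N) 1)) (trans (extend-top (3 + N)) edge-last)
    rotation (suc zero) (suc (suc j)) _ =
      trans (cong₂ extend (+-comm (suc j) 1) (+-comm (2 + N) 1)) (extend-right (2 + j) (λ ()))
    rotation (suc (suc i)) j (_ , i≤j , j≤3+N) with m≤n⇒m<n∨m≡n j≤3+N | m≤n⇒m<n∨m≡n i≤j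
    ... | inj₂ refl  | _         = rotation-last-column i i≤j
    ... | inj₁ j<3+N | inj₁ i<j  = rotation-interior i j i<j j<3+N
    ... | inj₁ j<3+N | inj₂ refl = begin
      extend (j ∸ j + 1) ((3 + N) ∸ j + 1)      ≡⟨ cong (λ u → extend (u + 1) ((3 + N) ∸ j + 1)) (n∸n≡0 j) ⟩
      edge ((3 + N) ∸ j + 1)                    ≡⟨ edge-palindrome j (s≤s z≤n) (<⇒≤ j<3+N) ⟩
      edge j                                    ≡⟨ sym (extend-diagonal j (λ ()) (<⇒≢ j<3+N)) ⟩
      extend j j                                ∎
      where open ≡-Reasoning

    -- The reflection reverses the first row (a palindrome), swaps the last
    -- column with the diagonal (which carry the same values), and acts as the
    -- reflection of b on the interior.
    reflection-interior : ∀ i j → 2 + i < j → j < 3 + N → extend (2 + i) ((3 + N) ∸ j + (2 + i)) ≡ extend (2 + i) j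
    reflection-interior i (suc (suc (suc j))) (s≤s (s≤s (s≤s i≤j))) (s≤s (s≤s (s≤s j<N))) = begin
      extend (2 + i) (N ∸ j + (2 + i))        ≡⟨ cong (extend (2 + i)) column ⟩
      extend (2 + i) (2 + w)                  ≡⟨ extend-interior (2 + i) (2 + w) (λ ()) (<⇒≢ (s≤s (s≤s (s≤s w≤N)))) (<⇒≢ (s≤s (s≤s i<w))) ⟩
      b (1 + i) w                             ≡⟨ subst (λ u → b (1 + i) u ≡ b (1 + i) (1 + j))
                                                   (trans (+-suc (N ∸ suc j) i) (cong (_+ i) (sym (+-∸-assoc 1 j<N))))
                                                   (hb (1 + i) (1 + j) (s≤s z≤n , s≤s i≤j , j<N)) ⟩
      b (1 + i) (1 + j)                       ≡⟨ sym (extend-interior (2 + i) (3 + j) (λ ()) (<⇒≢ (s≤s (s≤s (s≤s j<N)))) (<⇒≢ (s≤s (s≤s (s≤s i≤j))))) ⟩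
      extend (2 + i) (3 + j)                  ∎
      where
      open ≡-Reasoning
      -- the entry (1 + i, w) of b is the mirror image of (1 + i, 1 + j)
      w : ℕ
      w = N ∸ j + i
      column : N ∸ j + (2 + i) ≡ 2 + w
      column = trans (+-suc (N ∸ j) (suc i)) (cong suc (+-suc (N ∸ j) i))
      w≤N : w ≤ N
      w≤N = ≤-trans (+-monoʳ-≤ (N ∸ j) i≤j) (≤-reflexive (m∸n+n≡m (<⇒≤ j<N)))
      i<w : i < w
      i<w = m<n+m i (m<n⇒0<n∸m j<N)

    reflection : RefFixed (3 + N) extend
    reflection (suc zero) j (_ , 1≤j , j≤3+N) = edge-palindrome j 1≤j j≤3+N
    reflection (suc (suc i)) j (_ , i≤j , j≤3+N) with m≤n⇒m<n∨m≡n j≤3+N | m≤n⇒m<n∨m≡n i≤j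
    ... | inj₂ refl  | inj₂ refl   = cong (λ u → extend (3 + N) (u + (3 + N))) (n∸n≡0 (3 + N))
    ... | inj₁ j<3+N | inj₁ i<j    = reflection-interior i j i<j j<3+N
    ... | inj₂ refl  | inj₁ i<3+N  = begin
      extend (2 + i) ((3 + N) ∸ (3 + N) + (2 + i)) ≡⟨ cong (λ u → extend (2 + i) (u + (2 + i))) (n∸n≡0 (3 + N)) ⟩
      extend (2 + i) (2 + i)                      ≡⟨ extend-diagonal (2 + i) (λ ()) (<⇒≢ i<3+N) ⟩
      edge (2 + i)                                ≡⟨ sym (extend-right (2 + i) (λ ())) ⟩
      extend (2 + i) (3 + N)                      ∎
      where open ≡-Reasoning
    ... | inj₁ j<3+N | inj₂ refl   = begin
      extend j ((3 + N) ∸ j + j)                  ≡⟨ cong (extend j) (m∸n+n≡m (<⇒≤ j<3+N)) ⟩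
      extend j (3 + N)                            ≡⟨ extend-right j (λ ()) ⟩
      edge j                                      ≡⟨ sym (extend-diagonal j (λ ()) (<⇒≢ j<3+N)) ⟩
      extend j j                                  ∎
      where open ≡-Reasoning

    extend-DST : IsDST (3 + N) extend
    extend-DST = steinhaus , rotation , reflection

  core-extend : ∀ i j → Index N i j → core extend i j ≡ b i j
  core-extend (suc i) j (_ , i≤j , j≤N) =
    extend-interior (2 + i) (2 + j) (λ ()) (<⇒≢ (s≤s (s≤s (s≤s j≤N)))) (<⇒≢ (s≤s (s≤s i≤j)))

Within : ℕ → IndexSet → Set
Within n G = ∀ i j → G i j → Index n i j

Determines : (Triangle → Set) → ℕ → IndexSet → Set
Determines V n G = ∀ a b → V a → V b → (∀ i j → G i j → a i j ≡ b i j) →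
                   ∀ i j → Index n i j → a i j ≡ b i j

Realises : (Triangle → Set) → IndexSet → Set
Realises V G = ∀ (f : ℕ → ℕ → Bool) → ∃[ a ] (V a × (∀ i j → G i j → a i j ≡ f i j))

Generates : (Triangle → Set) → ℕ → IndexSet → Set
Generates V n G = Within n G × Determines V n G × Realises V G

_≐_ : IndexSet → IndexSet → Set
G ≐ H = ∀ p q → (G p q → H p q) × (H p q → G p q)

≐-sym : ∀ {G H} → G ≐ H → H ≐ G
≐-sym G≐H p q = swap (G≐H p q)

Generates-≐ : ∀ {V n G H} → G ≐ H → Generates V n G → Generates V n H
Generates-≐ G≐H (within , determines , realises) =
  (λ i j → within i j ∘ proj₂ (G≐H i j)) ,
  (λ a b aV bV agree → determines a b aV bV (λ i j → agree i j ∘ proj₁ (G≐H i j))) ,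
  (λ f → let (a , aV , matches) = realises f in a , aV , (λ i j → matches i j ∘ proj₂ (G≐H i j)))

Empty : IndexSet
Empty _ _ = ⊥

Generates-Empty : ∀ {V : Triangle → Set} n → V zeroTriangle →
                  (∀ a → V a → ∀ i j → Index n i j → a i j ≡ false) → Generates V n Empty
Generates-Empty n zeroV onlyZero =
  (λ _ _ ()) ,
  (λ a b aV bV _ i j ix → trans (onlyZero a aV i j ix) (sym (onlyZero b bV i j ix))) ,
  (λ _ → zeroTriangle , zeroV , λ _ _ ())

-- for even n every element of DST(n) is balanced, so an index set generating
-- DST(n) generates its balanced part
Generates-balanced : ∀ h {G} → Generates (IsDST (h + h)) (h + h) G → Generates (Balanced (h + h)) (h + h) G
Generates-balanced h (within , determines , realises) =
  within ,
  (λ a b aB bB → determines a b (proj₁ aB) (proj₁ bB)) ,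
  (λ f → let (a , aD , matches) = realises f in a , (aD , topRow-sum-even h a aD) , matches)

data Shift (G : IndexSet) : IndexSet where
  shift : ∀ {p q} → G p q → Shift G (suc p) (suc (suc q))

data WithTop (k : ℕ) (G : IndexSet) : IndexSet where
  top  : WithTop k G 1 k
  rest : ∀ {p q} → G p q → WithTop k G p q

Shift-within : ∀ N {G} → Within N G → Within (3 + N) (Shift G)
Shift-within N within (suc p) (suc (suc q)) (shift g) with within p q g
... | _ , p≤q , q≤N = s≤s z≤n , m≤n⇒m≤1+n (s≤s p≤q) , s≤s (s≤s (m≤n⇒m≤1+n q≤N))

-- Their cores are balanced and agree on G,
-- hence agree, and the difference is killed by border-kernel.
layer-determines : ∀ N {G} k → Determines (Balanced N) N G → 2 ≤ k → k ≤ 2 + N →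
                   ∀ a b → IsDST (3 + N) a → IsDST (3 + N) b →
                   (∀ i j → Shift G i j → a i j ≡ b i j) → a 1 k ≡ b 1 k →
                   ∀ i j → Index (3 + N) i j → a i j ≡ b i j
layer-determines N k determines 2≤k k≤2+N a b aD bD agree a1k≡b1k i j ix =
  ⊕≡false⇒≡ a b i j (border-kernel N (a ⊕ b) (⊕-DST (3 + N) a b aD bD) core-difference≡0
                                   k 2≤k k≤2+N (≡⇒xor≡false (a 1 k) (b 1 k) a1k≡b1k) i j ix)
  where
  cores-agree : ∀ i j → Index N i j → core a i j ≡ core b i j
  cores-agree = determines (core a) (core b) (core-balanced N a aD) (core-balanced N b bD)
                           (λ p q g → agree (suc p) (suc (suc q)) (shift g))
  core-difference≡0 : ∀ i j → Index N i j → core (a ⊕ b) i j ≡ false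
  core-difference≡0 i j ix = ≡⇒xor≡false (core a i j) (core b i j) (cores-agree i j ix)

-- Adding a layer with a free entry (1, k): the bit c of the border extension
-- is chosen to give the prescribed value at (1, k).
top-layer : ∀ N {G} k → Generates (Balanced N) N G → 2 ≤ k → k ≤ 2 + N →
            Generates (IsDST (3 + N)) (3 + N) (WithTop k (Shift G))
top-layer N {G} k (within , determines , realises) 2≤k k≤2+N = within⁺ , determines⁺ , realises⁺
  where
  within⁺ : Within (3 + N) (WithTop k (Shift G))
  within⁺ .1 .k top = s≤s z≤n , ≤-trans (n≤1+n 1) 2≤k , m≤n⇒m≤1+n k≤2+N
  within⁺ i j (rest g) = Shift-within N within i j g
  determines⁺ : Determines (IsDST (3 + N)) (3 + N) (WithTop k (Shift G))
  determines⁺ a b aD bD agree =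
    layer-determines N k determines 2≤k k≤2+N a b aD bD (λ i j → agree i j ∘ rest) (agree 1 k top)
  realises⁺ : Realises (IsDST (3 + N)) (WithTop k (Shift G))
  realises⁺ f with realises (λ p q → f (suc p) (suc (suc q)))
  ... | b , bB , b-matches = extend , extend-DST , matches
    where
    c : Bool
    c = f 1 k xor window (b 1) 1 (k ∸ 2)
    open BorderExtension N b c
    open OfBalanced bB
    matches : ∀ i j → WithTop k (Shift G) i j → extend i j ≡ f i j
    matches .1 .k top = trans (extend-topRow k 2≤k k≤2+N) (xor-cancelʳ (f 1 k) (window (b 1) 1 (k ∸ 2)))
    matches (suc p) (suc (suc q)) (rest (shift g)) =
      trans (core-extend p q (within p q g)) (b-matches p q g)

balanced-middle : ∀ h a → Balanced (3 + (h + h)) a → a 1 (2 + h) ≡ false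
balanced-middle h a (aD , sum≡0) = trans (sym (topRow-sum-odd h a aD)) sum≡0

-- Adding a layer without a free entry, from even size 2h to odd size 3 + 2h:
-- the middle entry (1, 2 + h) of the first row plays the role of (1, k), and
-- the bit c is chosen to make it zero, so that the extension is balanced.
balanced-layer : ∀ h {G} → Generates (Balanced (h + h)) (h + h) G →
                 Generates (Balanced (3 + (h + h))) (3 + (h + h)) (Shift G)
balanced-layer h {G} (within , determines , realises) = Shift-within (h + h) within , determines⁺ , realises⁺
  where
  determines⁺ : Determines (Balanced (3 + (h + h))) (3 + (h + h)) (Shift G)
  determines⁺ a b aB bB agree =
    layer-determines (h + h) (2 + h) determines (s≤s (s≤s z≤n)) (s≤s (s≤s (m≤m+n h h)))
      a b (proj₁ aB) (proj₁ bB) agree (trans (balanced-middle h a aB) (sym (balanced-middle h b bB)))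
  realises⁺ : Realises (Balanced (3 + (h + h))) (Shift G)
  realises⁺ f with realises (λ p q → f (suc p) (suc (suc q)))
  ... | b , bB , b-matches = extend , (extend-DST , extend-balanced) , matches
    where
    c : Bool
    c = window (b 1) 1 h
    open BorderExtension (h + h) b c
    open OfBalanced bB
    extend-balanced : window (extend 1) 1 (3 + (h + h)) ≡ false
    extend-balanced = begin
      window (extend 1) 1 (3 + (h + h))  ≡⟨ topRow-sum-odd h extend extend-DST ⟩
      extend 1 (2 + h)                   ≡⟨ extend-topRow (2 + h) (s≤s (s≤s z≤n)) (s≤s (s≤s (m≤m+n h h))) ⟩
      c xor c                            ≡⟨ xor-same c ⟩
      false                              ∎
      where open ≡-Reasoning
    matches : ∀ i j → Shift G i j → extend i j ≡ f i j
    matches (suc p) (suc (suc q)) (shift g) = trans (core-extend p q (within p q g)) (b-matches p q g)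

even-or-odd : ∀ n → n % 2 ≡ 0 ⊎ n % 2 ≡ 1
even-or-odd zero          = inj₁ refl
even-or-odd (suc zero)    = inj₂ refl
even-or-odd (suc (suc n)) = even-or-odd n

even⇒suc-odd : ∀ n → n % 2 ≡ 0 → suc n % 2 ≡ 1
even⇒suc-odd zero          _ = refl
even⇒suc-odd (suc (suc n)) e = even⇒suc-odd n e

suc-odd⇒even : ∀ n → suc n % 2 ≡ 1 → n % 2 ≡ 0
suc-odd⇒even zero          _ = refl
suc-odd⇒even (suc (suc n)) o = suc-odd⇒even n o

half : ∀ n → n % 2 ≡ 0 → ∃[ h ] (n ≡ h + h)
half zero          _ = 0 , refl
half (suc (suc n)) e with half n e
... | h , refl = suc h , cong suc (sym (+-suc h h))

3+/3 : ∀ n → (3 + n) / 3 ≡ suc (n / 3)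
3+/3 n = m/n≡1+[m∸n]/n {3 + n} {3} (s≤s (s≤s (s≤s z≤n)))

s*3+/3 : ∀ s n → (s * 3 + n) / 3 ≡ s + n / 3
s*3+/3 zero    n = refl
s*3+/3 (suc s) n = trans (3+/3 (s * 3 + n)) (cong suc (s*3+/3 s n))

mDST-6+ : ∀ n → mDST (6 + n) ≡ suc (mDST n)
mDST-6+ n = cong (_+ δ1mod6 n) (m/n≡1+[m∸n]/n {6 + (n + 3)} {6} (s≤s (s≤s (s≤s (s≤s (s≤s (s≤s z≤n)))))))

mDST-3+ : ∀ n → n % 2 ≡ 0 → mDST (3 + n) ≡ suc (mDST n)
mDST-3+ zero _ = refl
mDST-3+ (suc (suc zero)) _ = refl
mDST-3+ (suc (suc (suc (suc zero)))) _ = refl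
mDST-3+ (suc (suc (suc (suc (suc (suc n)))))) e =
  trans (mDST-6+ (3 + n)) (trans (cong suc (mDST-3+ n e)) (cong suc (sym (mDST-6+ n))))

odd-row-bound : ∀ n → n % 2 ≡ 0 → ∀ i → i < mDST n → 2 * i + 1 ≤ n / 3
odd-row-bound (suc (suc (suc (suc zero)))) _ zero _ = s≤s z≤n
odd-row-bound (suc (suc (suc (suc zero)))) _ (suc i) (s≤s ())
odd-row-bound (suc (suc (suc (suc (suc (suc n)))))) _ zero _ =
  subst (1 ≤_) (sym (s*3+/3 2 n)) (s≤s z≤n)
odd-row-bound (suc (suc (suc (suc (suc (suc n)))))) e (suc i) 1+i<m =
  subst₂ _≤_ (next-odd-row i) (sym (s*3+/3 2 n))
    (s≤s (s≤s (odd-row-bound n e i (≤-pred (subst (suc i <_) (mDST-6+ n) 1+i<m)))))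
  where
  next-odd-row : ∀ i → 2 + (2 * i + 1) ≡ 2 * suc i + 1
  next-odd-row = solve-∀

shifted-row : ∀ s n j → ValidChoice (s * 3 + n) j → ∀ r → 1 ≤ r → r ≤ n / 3 →
              2 * r + s * 2 ≤ j (s + r) × j (s + r) ≤ (s * 3 + n) ∸ (s + r)
shifted-row s n j valid r 1≤r r≤n/3
  with valid (s + r) (≤-trans 1≤r (m≤n+m r s))
             (inj₁ (subst (s + r ≤_) (sym (s*3+/3 s n)) (+-monoʳ-≤ s r≤n/3)))
... | lower , upper = subst (_≤ j (s + r)) (twice s r) lower , upper
  where
  twice : ∀ s r → 2 * (s + r) ≡ 2 * r + s * 2
  twice = solve-∀

shifted-choice : ∀ s n j → n % 2 ≡ 0 → ValidChoice (s * 3 + n) j →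
                 ValidChoice n (λ t → j (s + t) ∸ s * 2)
shifted-choice s n j e valid i 1≤i (inj₂ (_ , odd)) = ⊥-elim (0≢1+n (trans (sym e) odd))
shifted-choice s n j e valid i 1≤i (inj₁ i≤n/3) with shifted-row s n j valid i 1≤i i≤n/3
... | lower , upper =
  m+n≤o⇒m≤o∸n (2 * i) lower ,
  ≤-trans (∸-monoˡ-≤ (s * 2) upper) (≤-reflexive remaining)
  where
  remaining : (s * 3 + n) ∸ (s + i) ∸ s * 2 ≡ n ∸ i
  remaining = begin
    (s * 3 + n) ∸ (s + i) ∸ s * 2        ≡⟨ ∸-+-assoc (s * 3 + n) (s + i) (s * 2) ⟩
    (s * 3 + n) ∸ (s + i + s * 2)        ≡⟨ cong ((s * 3 + n) ∸_) (regroup s i) ⟩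
    (s * 3 + n) ∸ (s * 3 + i)            ≡⟨ [m+n]∸[m+o]≡n∸o (s * 3) n i ⟩
    n ∸ i                                ∎
    where
    open ≡-Reasoning
    regroup : ∀ s i → s + i + s * 2 ≡ s * 3 + i
    regroup = solve-∀

GD-for-even : ℕ → (ℕ → ℕ) → IndexSet
GD-for-even n j p q = ∃[ i ] (i < mDST n × p ≡ 2 * i + 1 × q ≡ j (2 * i + 1))

GD-for-odd : ℕ → (ℕ → ℕ) → IndexSet
GD-for-odd n j p q = (p ≡ 1 × q ≡ j 1) ⊎ ∃[ i ] (1 ≤ i × i < mDST n × p ≡ 2 * i × q ≡ j (2 * i))

GD-even : ∀ n j → n % 2 ≡ 0 → GD n j ≐ GD-for-even n j
GD-even n j e p q rewrite e = id , id

GD-odd : ∀ n j → n % 2 ≡ 1 → GD-for-odd n j ≐ GD n j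
GD-odd n j o p q rewrite o = id , id

GD-empty : ∀ n j → mDST n ≡ 0 → Empty ≐ GD-for-even n j
GD-empty n j m≡0 p q = (λ ()) , λ (i , i<m , _) → n≮0 (subst (i <_) m≡0 i<m)

unshift : ∀ s n j → ValidChoice (s * 3 + n) j → ∀ r → 1 ≤ r → r ≤ n / 3 →
          s * 2 + (j (s + r) ∸ s * 2) ≡ j (s + r)
unshift s n j valid r 1≤r r≤n/3 =
  m+[n∸m]≡n (m+n≤o⇒n≤o (2 * r) (proj₁ (shifted-row s n j valid r 1≤r r≤n/3)))

odd-layer : ∀ n j → n % 2 ≡ 0 → ValidChoice (3 + n) j →
            WithTop (j 1) (Shift (GD-for-even n (λ t → j (suc t) ∸ 2))) ≐ GD-for-odd (3 + n) j
odd-layer n j e valid p q = to , from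
  where
  row : ∀ i → suc (2 * i + 1) ≡ 2 * suc i
  row = solve-∀
  column : ∀ i → i < mDST n → suc (suc (j (suc (2 * i + 1)) ∸ 2)) ≡ j (2 * suc i)
  column i i<m = trans (unshift 1 n j valid (2 * i + 1) (m≤n+m 1 (2 * i)) (odd-row-bound n e i i<m))
                       (cong j (row i))
  to : WithTop (j 1) (Shift (GD-for-even n (λ t → j (suc t) ∸ 2))) p q → GD-for-odd (3 + n) j p q
  to top = inj₁ (refl , refl)
  to (rest (shift (i , i<m , refl , refl))) =
    inj₂ (suc i , s≤s z≤n , subst (suc i <_) (sym (mDST-3+ n e)) (s≤s i<m) , row i , column i i<m)
  from : GD-for-odd (3 + n) j p q → WithTop (j 1) (Shift (GD-for-even n (λ t → j (suc t) ∸ 2))) p q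
  from (inj₁ (refl , refl)) = top
  from (inj₂ (suc i , _ , 1+i<m , refl , refl)) =
    rest (subst₂ (Shift (GD-for-even n (λ t → j (suc t) ∸ 2))) (row i) (column i i<m)
                 (shift (i , i<m , refl , refl)))
    where
    i<m : i < mDST n
    i<m = ≤-pred (subst (suc i <_) (mDST-3+ n e) 1+i<m)

even-layer : ∀ n j → n % 2 ≡ 0 → ValidChoice (6 + n) j →
             WithTop (j 1) (Shift (Shift (GD-for-even n (λ t → j (2 + t) ∸ 4)))) ≐ GD-for-even (6 + n) j
even-layer n j e valid p q = to , from
  where
  row : ∀ i → suc (suc (2 * i + 1)) ≡ 2 * suc i + 1
  row = solve-∀
  column : ∀ i → i < mDST n → 4 + (j (2 + (2 * i + 1)) ∸ 4) ≡ j (2 * suc i + 1)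
  column i i<m = trans (unshift 2 n j valid (2 * i + 1) (m≤n+m 1 (2 * i)) (odd-row-bound n e i i<m))
                       (cong j (row i))
  to : WithTop (j 1) (Shift (Shift (GD-for-even n (λ t → j (2 + t) ∸ 4)))) p q → GD-for-even (6 + n) j p q
  to top = 0 , subst (0 <_) (sym (mDST-6+ n)) (s≤s z≤n) , refl , refl
  to (rest (shift (shift (i , i<m , refl , refl)))) =
    suc i , subst (suc i <_) (sym (mDST-6+ n)) (s≤s i<m) , row i , column i i<m
  from : GD-for-even (6 + n) j p q → WithTop (j 1) (Shift (Shift (GD-for-even n (λ t → j (2 + t) ∸ 4)))) p q
  from (zero , _ , refl , refl) = top
  from (suc i , 1+i<m , refl , refl) =
    rest (subst₂ (Shift (Shift (GD-for-even n (λ t → j (2 + t) ∸ 4)))) (row i) (column i i<m)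
                 (shift (shift (i , i<m , refl , refl))))
    where
    i<m : i < mDST n
    i<m = ≤-pred (subst (suc i <_) (mDST-6+ n) 1+i<m)

four-layer : ∀ j → WithTop (j 1) (Shift Empty) ≐ GD-for-even 4 j
four-layer j p q = to , from
  where
  to : WithTop (j 1) (Shift Empty) p q → GD-for-even 4 j p q
  to top = 0 , s≤s z≤n , refl , refl
  to (rest (shift ()))
  from : GD-for-even 4 j p q → WithTop (j 1) (Shift Empty) p q
  from (zero , _ , refl , refl) = top
  from (suc i , s≤s () , _)

DST-0-trivial : ∀ a → IsDST 0 a → ∀ i j → Index 0 i j → a i j ≡ false
DST-0-trivial a _ i j (1≤i , i≤j , j≤0) with ≤-trans 1≤i (≤-trans i≤j j≤0)
... | ()

-- in size 2 the symmetries give a 1 1 = a 1 2 = a 2 2 = a 1 1 xor a 1 2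
DST-2-trivial : ∀ a → IsDST 2 a → ∀ i j → Index 2 i j → a i j ≡ false
DST-2-trivial a (sa , ra , ha) = zeroTopRow⇒zero 2 a sa topRow
  where
  a11≡0 : a 1 1 ≡ false
  a11≡0 = begin
    a 1 1              ≡⟨ ra 2 2 (s≤s z≤n , ≤-refl , ≤-refl) ⟩
    a 2 2              ≡⟨ sa 2 2 (s≤s (s≤s z≤n)) ≤-refl ≤-refl ⟩
    a 1 1 xor a 1 2    ≡⟨ ≡⇒xor≡false (a 1 1) (a 1 2) (sym (ha 1 1 (s≤s z≤n , s≤s z≤n , s≤s z≤n))) ⟩
    false              ∎
    where open ≡-Reasoning
  topRow : ∀ j → 1 ≤ j → j ≤ 2 → a 1 j ≡ false
  topRow (suc zero) _ _ = a11≡0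
  topRow (suc (suc zero)) _ _ = trans (ha 1 1 (s≤s z≤n , s≤s z≤n , s≤s z≤n)) a11≡0
  topRow (suc (suc (suc j))) _ (s≤s (s≤s ()))

Balanced-1-trivial : ∀ a → Balanced 1 a → ∀ i j → Index 1 i j → a i j ≡ false
Balanced-1-trivial a (_ , sum≡0) (suc zero) (suc zero) _ = trans (sym (xor-identityʳ (a 1 1))) sum≡0
Balanced-1-trivial a _ (suc (suc i)) (suc zero) (_ , s≤s () , _)
Balanced-1-trivial a _ (suc i) (suc (suc j)) (_ , _ , s≤s ())

GD-Generates : ℕ → Set
GD-Generates n = ∀ j → ValidChoice n j → IsGeneratingIndexSetDST n (GD n j)

odd-step : ∀ n → n % 2 ≡ 0 → GD-Generates n → GD-Generates (3 + n)
odd-step n e induction j valid with half n e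
... | h , refl =
  Generates-≐ (GD-odd (3 + n) j odd) (Generates-≐ (odd-layer n j e valid)
    (top-layer n (j 1) core-generates (proj₁ first-row) (proj₂ first-row)))
  where
  odd : (3 + n) % 2 ≡ 1
  odd = even⇒suc-odd (2 + n) e
  first-row : 2 ≤ j 1 × j 1 ≤ 2 + n
  first-row = valid 1 (s≤s z≤n) (inj₂ (refl , odd))
  core-generates : Generates (Balanced n) n (GD-for-even n (λ t → j (suc t) ∸ 2))
  core-generates = Generates-balanced h (Generates-≐ (GD-even n _ e)
                     (induction _ (shifted-choice 1 n j e valid)))

even-step : ∀ n → n % 2 ≡ 0 → GD-Generates n → GD-Generates (6 + n)
even-step n e induction j valid with half n e
... | h , refl =
  Generates-≐ (≐-sym (GD-even (6 + n) j e)) (Generates-≐ (even-layer n j e valid)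
    (top-layer (3 + n) (j 1) (balanced-layer h core-generates) (proj₁ first-row) (proj₂ first-row)))
  where
  first-row : 2 ≤ j 1 × j 1 ≤ 5 + n
  first-row = valid 1 (s≤s z≤n) (inj₁ (subst (1 ≤_) (sym (s*3+/3 2 n)) (s≤s z≤n)))
  core-generates : Generates (Balanced n) n (GD-for-even n (λ t → j (2 + t) ∸ 4))
  core-generates = Generates-balanced h (Generates-≐ (GD-even n _ e)
                     (induction _ (shifted-choice 2 n j e valid)))

-- Even n: for n = 0, 2 both G_D and DST(n) are trivial, for n = 4 the set
-- G_D = {(1, j₁)} is a top layer over the (trivial) balanced part of DST(1),
-- and beyond that even-step applies.
GD-generates-even : ∀ n → n % 2 ≡ 0 → GD-Generates n
GD-generates-even zero _ j _ =
  Generates-≐ (GD-empty 0 j refl) (Generates-Empty 0 (zero-DST 0) DST-0-trivial)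
GD-generates-even (suc (suc zero)) _ j _ =
  Generates-≐ (GD-empty 2 j refl) (Generates-Empty 2 (zero-DST 2) DST-2-trivial)
GD-generates-even (suc (suc (suc (suc zero)))) _ j valid =
  Generates-≐ (four-layer j)
    (top-layer 1 (j 1) (Generates-Empty 1 (zero-DST 1 , refl) Balanced-1-trivial)
               (proj₁ first-row) (proj₂ first-row))
  where
  first-row : 2 ≤ j 1 × j 1 ≤ 3
  first-row = valid 1 (s≤s z≤n) (inj₁ (s≤s z≤n))
GD-generates-even (suc (suc (suc (suc (suc (suc n)))))) e =
  even-step n e (GD-generates-even n e)

-- for n = 1 no valid choice exists (j₁ would lie in {2, …, 0})
GD-generates-odd : ∀ n → n % 2 ≡ 1 → GD-Generates n
GD-generates-odd (suc zero) _ j valid with valid 1 (s≤s z≤n) (inj₂ (refl , refl))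
... | 2≤j₁ , j₁≤0 with ≤-trans 2≤j₁ j₁≤0
... | ()
GD-generates-odd (suc (suc (suc n))) odd =
  odd-step n even (GD-generates-even n even)
  where
  even : n % 2 ≡ 0
  even = suc-odd⇒even (2 + n) odd

mainTheorem10 : (n : ℕ) (j : ℕ → ℕ) → ValidChoice n j →
    IsGeneratingIndexSetDST n (GD n j)
mainTheorem10 n with even-or-odd n
... | inj₁ even = GD-generates-even n even
... | inj₂ odd  = GD-generates-odd n odd
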